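{- For every positive integer $n$, \[ \sum_{k=1}^n\binom nk\binom{n+k}k(-1)^{n-k}kH_k=n(n+1)(2H_n-1). \]
   Context: $H_m=\sum_{i=1}^m \frac1i$ denotes the $m$-th harmonic number, with $H_0=0$. -}

module Defs where

open import Data.Nat as ℕ using (ℕ; zero; suc)
open import Data.Nat.Combinatorics using (_C_)
open import Data.Integer as ℤ using (ℤ; +_)
open import Data.Rational using (ℚ; 0ℚ; _+_; _*_; _/_; -_)

H : ℕ → ℚ
H zero = 0ℚ
H (suc m) = H m + (+ 1 / suc m)

ℕ→ℚ : ℕ → ℚ
ℕ→ℚ k = + k / 1

sign : ℕ → ℚ
sign zero = + 1 / 1
sign (suc m) = - sign m

Σ₁ : ℕ → (ℕ → ℚ) → ℚ
Σ₁ zero f = 0ℚ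
Σ₁ (suc n) f = Σ₁ n f + f (suc n)

module Submission where

-- Write A(n,k) = C(n,k)·C(n+k,k)·(-1)^(n-k) (the coefficients of the shifted
-- Legendre polynomial) and E_m f = Σ_{k=0}^m A(m,k)·f(k).  The theorem says
-- E_n (k ↦ k·H_k) = n(n+1)(2H_n - 1).
--
-- Only two facts about the binomials are used: A(n,0) = (-1)^n and the column
-- recurrence (k+1)²·A(n,k+1) = (k-n)(k+n+1)·A(n,k) (A-rec).  Summation by
-- parts against A-rec shows that E_m annihilates the adjoint operator,
--   E_m ((k-m)(k+m+1)·v(k+1) - k²·v(k)) = 0   for every v      (annihilate),
-- and induction on k turns A-rec into the row recurrence
-- (n+1-k)·A(n+1,k) = -(n+k+1)·A(n,k), which relates E_{n+1} to E_n (row-step).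
-- Suitable choices of v then give E_m 1 = 1 and E_m H = 2H_m (by induction on
-- m through row-step), E_m k = m(m+1), and E_m (k·H_k) = m(m+1)·E_m H - E_m k,
-- which is the theorem.

open import Defs
open import Data.Nat as ℕ using (ℕ; _∸_)
open import Data.Nat.Combinatorics using (_C_)
open import Data.Rational using (ℚ; _+_; _*_; _-_; 1ℚ)
open import Relation.Binary.PropositionalEquality using (_≡_)

open import Data.Nat using (zero; suc; s≤s)
import Data.Nat.Properties as ℕP
import Data.Nat.Combinatorics as ℕC
import Data.Nat.Tactic.RingSolver as ℕ-Solver
open import Data.Integer as ℤ using (+_)
import Data.Integer.Properties as ℤP
import Data.Integer.Tactic.RingSolver as ℤ-Solver
open import Data.Rational using (0ℚ; -_; _/_; toℚᵘ)
import Data.Rational.Properties as ℚP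
import Data.Rational.Unnormalised as ℚᵘ
import Data.Rational.Unnormalised.Properties as ℚᵘP
open import Relation.Binary.PropositionalEquality
  using (refl; sym; trans; cong; cong₂; module ≡-Reasoning)
open import Relation.Nullary using (yes; no)
open import Relation.Nullary.Decidable using (dec⇒maybe)
open import Data.List using (_∷_; [])
open import Level using (0ℓ)
import Tactic.RingSolver.Core.AlmostCommutativeRing as ACR
open import Tactic.RingSolver using (solve; solve-∀)

ℚ-ring : ACR.AlmostCommutativeRing 0ℓ 0ℓ
ℚ-ring = ACR.fromCommutativeRing ℚP.+-*-commutativeRing (λ x → dec⇒maybe (0ℚ ℚP.≟ x))

-- Natural numbers inside ℚ

⟦_⟧ : ℕ → ℚ
⟦_⟧ = ℕ→ℚ

1/suc : ℕ → ℚ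
1/suc k = + 1 / suc k

-- The rational 2 (definitionally equal to ⟦ 2 ⟧).
two : ℚ
two = 1ℚ + 1ℚ

toℚᵘ-⟦⟧ : ∀ k → toℚᵘ ⟦ k ⟧ ℚᵘ.≃ ℚᵘ.mkℚᵘ (+ k) 0
toℚᵘ-⟦⟧ k = ℚP.toℚᵘ-fromℚᵘ (ℚᵘ.mkℚᵘ (+ k) 0)

⟦suc⟧ : ∀ k → ⟦ suc k ⟧ ≡ ⟦ k ⟧ + 1ℚ
⟦suc⟧ k = ℚP.toℚᵘ-injective (begin
  toℚᵘ ⟦ suc k ⟧                  ≈⟨ toℚᵘ-⟦⟧ (suc k) ⟩
  ℚᵘ.mkℚᵘ (+ suc k) 0             ≈⟨ ℚᵘ.*≡* numerators ⟩
  ℚᵘ.mkℚᵘ (+ k) 0 ℚᵘ.+ ℚᵘ.1ℚᵘ      ≈⟨ ℚᵘP.+-cong (ℚᵘP.≃-sym (toℚᵘ-⟦⟧ k)) ℚᵘP.≃-refl ⟩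
  toℚᵘ ⟦ k ⟧ ℚᵘ.+ toℚᵘ 1ℚ         ≈⟨ ℚᵘP.≃-sym (ℚP.toℚᵘ-homo-+ ⟦ k ⟧ 1ℚ) ⟩
  toℚᵘ (⟦ k ⟧ + 1ℚ)               ∎)
  where
  open ℚᵘP.≃-Reasoning
  shape : ∀ x → (+ 1 ℤ.+ x) ℤ.* + 1 ≡ (x ℤ.* + 1 ℤ.+ + 1 ℤ.* + 1) ℤ.* + 1
  shape = ℤ-Solver.solve-∀
  numerators : + suc k ℤ.* + 1 ≡ (+ k ℤ.* + 1 ℤ.+ + 1 ℤ.* + 1) ℤ.* + 1
  numerators = trans (cong (ℤ._* + 1) (ℤP.pos-+ 1 k)) (shape (+ k))

⟦+⟧ : ∀ m n → ⟦ m ℕ.+ n ⟧ ≡ ⟦ m ⟧ + ⟦ n ⟧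
⟦+⟧ zero n = sym (ℚP.+-identityˡ ⟦ n ⟧)
⟦+⟧ (suc m) n = begin
  ⟦ suc (m ℕ.+ n) ⟧      ≡⟨ ⟦suc⟧ (m ℕ.+ n) ⟩
  ⟦ m ℕ.+ n ⟧ + 1ℚ       ≡⟨ cong (_+ 1ℚ) (⟦+⟧ m n) ⟩
  ⟦ m ⟧ + ⟦ n ⟧ + 1ℚ     ≡⟨ swap ⟦ m ⟧ ⟦ n ⟧ ⟩
  ⟦ m ⟧ + 1ℚ + ⟦ n ⟧     ≡⟨ cong (_+ ⟦ n ⟧) (sym (⟦suc⟧ m)) ⟩
  ⟦ suc m ⟧ + ⟦ n ⟧      ∎
  where
  open ≡-Reasoning
  swap : ∀ a b → a + b + 1ℚ ≡ a + 1ℚ + b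
  swap = solve-∀ ℚ-ring

⟦*⟧ : ∀ m n → ⟦ m ℕ.* n ⟧ ≡ ⟦ m ⟧ * ⟦ n ⟧
⟦*⟧ zero n = sym (ℚP.*-zeroˡ ⟦ n ⟧)
⟦*⟧ (suc m) n = begin
  ⟦ n ℕ.+ m ℕ.* n ⟧          ≡⟨ ⟦+⟧ n (m ℕ.* n) ⟩
  ⟦ n ⟧ + ⟦ m ℕ.* n ⟧        ≡⟨ cong (λ x → ⟦ n ⟧ + x) (⟦*⟧ m n) ⟩
  ⟦ n ⟧ + ⟦ m ⟧ * ⟦ n ⟧      ≡⟨ collect ⟦ m ⟧ ⟦ n ⟧ ⟩
  (⟦ m ⟧ + 1ℚ) * ⟦ n ⟧       ≡⟨ cong (_* ⟦ n ⟧) (sym (⟦suc⟧ m)) ⟩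
  ⟦ suc m ⟧ * ⟦ n ⟧          ∎
  where
  open ≡-Reasoning
  collect : ∀ a b → b + a * b ≡ (a + 1ℚ) * b
  collect = solve-∀ ℚ-ring

1/suc-inverse : ∀ k → (⟦ k ⟧ + 1ℚ) * 1/suc k ≡ 1ℚ
1/suc-inverse k = ℚP.toℚᵘ-injective (begin
  toℚᵘ ((⟦ k ⟧ + 1ℚ) * 1/suc k)            ≡⟨ cong (λ x → toℚᵘ (x * 1/suc k)) (sym (⟦suc⟧ k)) ⟩
  toℚᵘ (⟦ suc k ⟧ * 1/suc k)               ≈⟨ ℚP.toℚᵘ-homo-* ⟦ suc k ⟧ (1/suc k) ⟩
  toℚᵘ ⟦ suc k ⟧ ℚᵘ.* toℚᵘ (1/suc k)        ≈⟨ ℚᵘP.*-cong (toℚᵘ-⟦⟧ (suc k)) (ℚP.toℚᵘ-fromℚᵘ (ℚᵘ.mkℚᵘ (+ 1) k)) ⟩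
  ℚᵘ.mkℚᵘ (+ suc k) 0 ℚᵘ.* ℚᵘ.mkℚᵘ (+ 1) k  ≈⟨ ℚᵘP.*-inverseʳ (ℚᵘ.mkℚᵘ (+ suc k) 0) ⟩
  ℚᵘ.1ℚᵘ                                   ∎)
  where open ℚᵘP.≃-Reasoning

1/suc-sum : ∀ n k → (⟦ n ⟧ + ⟦ k ⟧ + 1ℚ) * 1/suc (n ℕ.+ k) ≡ 1ℚ
1/suc-sum n k = trans (cong (λ x → (x + 1ℚ) * 1/suc (n ℕ.+ k)) (sym (⟦+⟧ n k))) (1/suc-inverse (n ℕ.+ k))

*-exchange : ∀ x c i → x * (c * i) ≡ c * x * i
*-exchange = solve-∀ ℚ-ring

divide : ∀ j {x y} → (⟦ j ⟧ + 1ℚ) * x ≡ y → x ≡ y * 1/suc j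
divide j {x} {y} e = begin
  x                              ≡⟨ sym (ℚP.*-identityʳ x) ⟩
  x * 1ℚ                         ≡⟨ cong (x *_) (sym (1/suc-inverse j)) ⟩
  x * ((⟦ j ⟧ + 1ℚ) * 1/suc j)   ≡⟨ *-exchange x (⟦ j ⟧ + 1ℚ) (1/suc j) ⟩
  (⟦ j ⟧ + 1ℚ) * x * 1/suc j     ≡⟨ cong (_* 1/suc j) e ⟩
  y * 1/suc j                    ∎
  where open ≡-Reasoning

cancel : ∀ j {x y} → (⟦ j ⟧ + 1ℚ) * x ≡ (⟦ j ⟧ + 1ℚ) * y → x ≡ y
cancel j {x} {y} e = begin
  x                              ≡⟨ divide j e ⟩
  (⟦ j ⟧ + 1ℚ) * y * 1/suc j     ≡⟨ sym (*-exchange y (⟦ j ⟧ + 1ℚ) (1/suc j)) ⟩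
  y * ((⟦ j ⟧ + 1ℚ) * 1/suc j)   ≡⟨ cong (y *_) (1/suc-inverse j) ⟩
  y * 1ℚ                         ≡⟨ ℚP.*-identityʳ y ⟩
  y                              ∎
  where open ≡-Reasoning

cancel² : ∀ j {x y} → (⟦ j ⟧ + 1ℚ) * (⟦ j ⟧ + 1ℚ) * x ≡ (⟦ j ⟧ + 1ℚ) * (⟦ j ⟧ + 1ℚ) * y → x ≡ y
cancel² j {x} {y} e = cancel j (cancel j
  (trans (sym (ℚP.*-assoc c c x)) (trans e (ℚP.*-assoc c c y))))
  where c = ⟦ j ⟧ + 1ℚ

Σ₀ : ℕ → (ℕ → ℚ) → ℚ
Σ₀ zero f = f 0
Σ₀ (suc m) f = Σ₀ m f + f (suc m)

Σ₀-cong : ∀ m {f g : ℕ → ℚ} → (∀ k → f k ≡ g k) → Σ₀ m f ≡ Σ₀ m g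
Σ₀-cong zero e = e 0
Σ₀-cong (suc m) e = cong₂ _+_ (Σ₀-cong m e) (e (suc m))

Σ₀-linear : ∀ m a b (f g : ℕ → ℚ) → Σ₀ m (λ k → a * f k + b * g k) ≡ a * Σ₀ m f + b * Σ₀ m g
Σ₀-linear zero a b f g = refl
Σ₀-linear (suc m) a b f g = trans
  (cong (_+ (a * f (suc m) + b * g (suc m))) (Σ₀-linear m a b f g))
  (regroup a b (Σ₀ m f) (Σ₀ m g) (f (suc m)) (g (suc m)))
  where
  regroup : ∀ a b F G x y → a * F + b * G + (a * x + b * y) ≡ a * (F + x) + b * (G + y)
  regroup = solve-∀ ℚ-ring

Σ₀-telescope : ∀ m (T : ℕ → ℚ) → Σ₀ m (λ k → T (suc k) - T k) ≡ T (suc m) - T 0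
Σ₀-telescope zero T = refl
Σ₀-telescope (suc m) T = trans
  (cong (_+ (T (suc (suc m)) - T (suc m))) (Σ₀-telescope m T))
  (collapse (T 0) (T (suc m)) (T (suc (suc m))))
  where
  collapse : ∀ t₀ t₁ t₂ → (t₁ - t₀) + (t₂ - t₁) ≡ t₂ - t₀
  collapse = solve-∀ ℚ-ring

Σ₀-Σ₁ : ∀ m (f : ℕ → ℚ) → Σ₀ m f ≡ f 0 + Σ₁ m f
Σ₀-Σ₁ zero f = sym (ℚP.+-identityʳ (f 0))
Σ₀-Σ₁ (suc m) f = trans (cong (_+ f (suc m)) (Σ₀-Σ₁ m f)) (ℚP.+-assoc (f 0) (Σ₁ m f) (f (suc m)))

-- Binomial coefficients

absorption : ∀ n k → suc k ℕ.* (suc n C suc k) ≡ suc n ℕ.* (n C k)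
absorption zero zero = refl
absorption zero (suc k)
  rewrite ℕC.k>n⇒nCk≡0 {1} {suc (suc k)} (s≤s (s≤s ℕ.z≤n))
        | ℕC.k>n⇒nCk≡0 {0} {suc k} (s≤s ℕ.z≤n) = ℕP.*-zeroʳ (suc (suc k))
absorption (suc n) zero = trans (ℕP.+-identityʳ _) (trans (ℕC.nC1≡n (suc (suc n))) (sym (ℕP.*-identityʳ (suc (suc n)))))
absorption (suc n) (suc k) = begin
  suc (suc k) ℕ.* (suc (suc n) C suc (suc k))  ≡⟨ cong (suc (suc k) ℕ.*_) (sym (pascal (suc n) (suc k))) ⟩
  suc (suc k) ℕ.* (a ℕ.+ b)                    ≡⟨ expand k a b ⟩
  a ℕ.+ suc k ℕ.* a ℕ.+ suc (suc k) ℕ.* b      ≡⟨ cong₂ (λ x y → a ℕ.+ x ℕ.+ y) (absorption n k) (absorption n (suc k)) ⟩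
  a ℕ.+ suc n ℕ.* (n C k) ℕ.+ suc n ℕ.* (n C suc k) ≡⟨ collect n a (n C k) (n C suc k) ⟩
  a ℕ.+ suc n ℕ.* (n C k ℕ.+ n C suc k)        ≡⟨ cong (λ x → a ℕ.+ suc n ℕ.* x) (pascal n k) ⟩
  a ℕ.+ suc n ℕ.* a                            ≡⟨ absorb n a ⟩
  suc (suc n) ℕ.* a                            ∎
  where
  open ≡-Reasoning
  pascal = ℕC.nCk+nC[k+1]≡[n+1]C[k+1]
  a = suc n C suc k
  b = suc n C suc (suc k)
  expand : ∀ k a b → suc (suc k) ℕ.* (a ℕ.+ b) ≡ a ℕ.+ suc k ℕ.* a ℕ.+ suc (suc k) ℕ.* b
  expand = ℕ-Solver.solve-∀
  collect : ∀ n a x y → a ℕ.+ suc n ℕ.* x ℕ.+ suc n ℕ.* y ≡ a ℕ.+ suc n ℕ.* (x ℕ.+ y)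
  collect = ℕ-Solver.solve-∀
  absorb : ∀ n a → a ℕ.+ suc n ℕ.* a ≡ suc (suc n) ℕ.* a
  absorb = ℕ-Solver.solve-∀

absorptionℚ : ∀ n k → (⟦ k ⟧ + 1ℚ) * ⟦ suc n C suc k ⟧ ≡ (⟦ n ⟧ + 1ℚ) * ⟦ n C k ⟧
absorptionℚ n k = begin
  (⟦ k ⟧ + 1ℚ) * ⟦ suc n C suc k ⟧  ≡⟨ cong (_* ⟦ suc n C suc k ⟧) (sym (⟦suc⟧ k)) ⟩
  ⟦ suc k ⟧ * ⟦ suc n C suc k ⟧     ≡⟨ sym (⟦*⟧ (suc k) (suc n C suc k)) ⟩
  ⟦ suc k ℕ.* (suc n C suc k) ⟧     ≡⟨ cong ⟦_⟧ (absorption n k) ⟩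
  ⟦ suc n ℕ.* (n C k) ⟧             ≡⟨ ⟦*⟧ (suc n) (n C k) ⟩
  ⟦ suc n ⟧ * ⟦ n C k ⟧             ≡⟨ cong (_* ⟦ n C k ⟧) (⟦suc⟧ n) ⟩
  (⟦ n ⟧ + 1ℚ) * ⟦ n C k ⟧          ∎
  where open ≡-Reasoning

binom-step : ∀ n k → (⟦ k ⟧ + 1ℚ) * ⟦ n C suc k ⟧ ≡ (⟦ n ⟧ - ⟦ k ⟧) * ⟦ n C k ⟧
binom-step n k = core ⟦ k ⟧ ⟦ n ⟧ ⟦ n C k ⟧ ⟦ n C suc k ⟧ ⟦ suc n C suc k ⟧
  (trans (sym (⟦+⟧ (n C k) (n C suc k))) (cong ⟦_⟧ (ℕC.nCk+nC[k+1]≡[n+1]C[k+1] n k)))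
  (absorptionℚ n k)
  where
  core : ∀ K N c c′ U → c + c′ ≡ U → (K + 1ℚ) * U ≡ (N + 1ℚ) * c → (K + 1ℚ) * c′ ≡ (N - K) * c
  core K N c c′ U pascal absorb = begin
    (K + 1ℚ) * c′                          ≡⟨ solve (K ∷ c ∷ c′ ∷ []) ℚ-ring ⟩
    (K + 1ℚ) * (c + c′) - (K + 1ℚ) * c     ≡⟨ cong (λ x → (K + 1ℚ) * x - (K + 1ℚ) * c) pascal ⟩
    (K + 1ℚ) * U - (K + 1ℚ) * c            ≡⟨ cong (_- (K + 1ℚ) * c) absorb ⟩
    (N + 1ℚ) * c - (K + 1ℚ) * c            ≡⟨ solve (K ∷ N ∷ c ∷ []) ℚ-ring ⟩
    (N - K) * c                            ∎
    where open ≡-Reasoning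

binom-diagonal-step : ∀ n k → (⟦ k ⟧ + 1ℚ) * ⟦ (n ℕ.+ suc k) C suc k ⟧ ≡ (⟦ n ⟧ + ⟦ k ⟧ + 1ℚ) * ⟦ (n ℕ.+ k) C k ⟧
binom-diagonal-step n k = begin
  (⟦ k ⟧ + 1ℚ) * ⟦ (n ℕ.+ suc k) C suc k ⟧  ≡⟨ cong (λ m → (⟦ k ⟧ + 1ℚ) * ⟦ m C suc k ⟧) (ℕP.+-suc n k) ⟩
  (⟦ k ⟧ + 1ℚ) * ⟦ suc (n ℕ.+ k) C suc k ⟧  ≡⟨ absorptionℚ (n ℕ.+ k) k ⟩
  (⟦ n ℕ.+ k ⟧ + 1ℚ) * ⟦ (n ℕ.+ k) C k ⟧    ≡⟨ cong (λ x → (x + 1ℚ) * ⟦ (n ℕ.+ k) C k ⟧) (⟦+⟧ n k) ⟩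
  (⟦ n ⟧ + ⟦ k ⟧ + 1ℚ) * ⟦ (n ℕ.+ k) C k ⟧  ∎
  where open ≡-Reasoning

-- The signed binomial (-1)^(n-k)·C(n,k) satisfies (k+1)·s(n,k+1) = (k-n)·s(n,k):
-- for k < n the sign flips, and for k ≥ n both sides vanish.
signed-binom-step : ∀ n k →
  (⟦ k ⟧ + 1ℚ) * (⟦ n C suc k ⟧ * sign (n ∸ suc k)) ≡ (⟦ k ⟧ - ⟦ n ⟧) * (⟦ n C k ⟧ * sign (n ∸ k))
signed-binom-step n k with k ℕP.<? n
... | yes k<n = trans
  (flip ⟦ k ⟧ ⟦ n ⟧ ⟦ n C k ⟧ ⟦ n C suc k ⟧ (sign (n ∸ suc k)) (binom-step n k))
  (cong (λ m → (⟦ k ⟧ - ⟦ n ⟧) * (⟦ n C k ⟧ * sign m)) (sym (ℕP.+-∸-assoc 1 k<n)))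
  where
  flip : ∀ K N c c′ s′ → (K + 1ℚ) * c′ ≡ (N - K) * c → (K + 1ℚ) * (c′ * s′) ≡ (K - N) * (c * - s′)
  flip K N c c′ s′ step = begin
    (K + 1ℚ) * (c′ * s′)     ≡⟨ solve (K ∷ c′ ∷ s′ ∷ []) ℚ-ring ⟩
    (K + 1ℚ) * c′ * s′       ≡⟨ cong (_* s′) step ⟩
    (N - K) * c * s′         ≡⟨ solve (K ∷ N ∷ c ∷ s′ ∷ []) ℚ-ring ⟩
    (K - N) * (c * - s′)     ∎
    where open ≡-Reasoning
... | no k≮n = vanish ⟦ k ⟧ ⟦ n ⟧ ⟦ n C k ⟧ ⟦ n C suc k ⟧ (sign (n ∸ k)) (sign (n ∸ suc k))
  (cong ⟦_⟧ (ℕC.k>n⇒nCk≡0 (s≤s (ℕP.≮⇒≥ k≮n)))) (binom-step n k)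
  where
  vanish : ∀ K N c c′ s s′ → c′ ≡ 0ℚ → (K + 1ℚ) * c′ ≡ (N - K) * c → (K + 1ℚ) * (c′ * s′) ≡ (K - N) * (c * s)
  vanish K N c _ s s′ refl step = begin
    (K + 1ℚ) * (0ℚ * s′)        ≡⟨ solve (K ∷ s ∷ s′ ∷ []) ℚ-ring ⟩
    - ((K + 1ℚ) * 0ℚ) * s       ≡⟨ cong (λ x → - x * s) step ⟩
    - ((N - K) * c) * s         ≡⟨ solve (K ∷ N ∷ c ∷ s ∷ []) ℚ-ring ⟩
    (K - N) * (c * s)           ∎
    where open ≡-Reasoning

A : ℕ → ℕ → ℚ
A n k = ⟦ n C k ⟧ * ⟦ (n ℕ.+ k) C k ⟧ * sign (n ∸ k)

A-initial : ∀ n → A n 0 ≡ sign n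
A-initial n = ℚP.*-identityˡ (sign n)

A-rec : ∀ n k → (⟦ k ⟧ + 1ℚ) * (⟦ k ⟧ + 1ℚ) * A n (suc k) ≡ (⟦ k ⟧ - ⟦ n ⟧) * (⟦ k ⟧ + ⟦ n ⟧ + 1ℚ) * A n k
A-rec n k = combine ⟦ k ⟧ ⟦ n ⟧ ⟦ n C k ⟧ ⟦ (n ℕ.+ k) C k ⟧ (sign (n ∸ k))
  ⟦ n C suc k ⟧ ⟦ (n ℕ.+ suc k) C suc k ⟧ (sign (n ∸ suc k))
  (signed-binom-step n k) (binom-diagonal-step n k)
  where
  combine : ∀ K N c d s c′ d′ s′ → (K + 1ℚ) * (c′ * s′) ≡ (K - N) * (c * s) → (K + 1ℚ) * d′ ≡ (N + K + 1ℚ) * d →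
            (K + 1ℚ) * (K + 1ℚ) * (c′ * d′ * s′) ≡ (K - N) * (K + N + 1ℚ) * (c * d * s)
  combine K N c d s c′ d′ s′ signed diagonal = begin
    (K + 1ℚ) * (K + 1ℚ) * (c′ * d′ * s′)          ≡⟨ solve (K ∷ c′ ∷ d′ ∷ s′ ∷ []) ℚ-ring ⟩
    ((K + 1ℚ) * (c′ * s′)) * ((K + 1ℚ) * d′)      ≡⟨ cong₂ _*_ signed diagonal ⟩
    ((K - N) * (c * s)) * ((N + K + 1ℚ) * d)      ≡⟨ solve (K ∷ N ∷ c ∷ d ∷ s ∷ []) ℚ-ring ⟩
    (K - N) * (K + N + 1ℚ) * (c * d * s)          ∎
    where open ≡-Reasoning

A-vanishes : ∀ n → A n (suc n) ≡ 0ℚ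
A-vanishes n = cancel² n (trans (A-rec n n) (zero-factor ⟦ n ⟧ (A n n)))
  where
  zero-factor : ∀ N a → (N - N) * (N + N + 1ℚ) * a ≡ (N + 1ℚ) * (N + 1ℚ) * 0ℚ
  zero-factor = solve-∀ ℚ-ring

A-row-rec : ∀ n k → (⟦ n ⟧ + 1ℚ - ⟦ k ⟧) * A (suc n) k + (⟦ n ⟧ + ⟦ k ⟧ + 1ℚ) * A n k ≡ 0ℚ
A-row-rec n zero = trans
  (cong₂ (λ x y → (⟦ n ⟧ + 1ℚ - 0ℚ) * x + (⟦ n ⟧ + 0ℚ + 1ℚ) * y) (A-initial (suc n)) (A-initial n))
  (opposite ⟦ n ⟧ (sign n))
  where
  opposite : ∀ N s → (N + 1ℚ - 0ℚ) * - s + (N + 0ℚ + 1ℚ) * s ≡ 0ℚ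
  opposite = solve-∀ ℚ-ring
A-row-rec n (suc k) = cancel² k (step ⟦ k ⟧ ⟦ n ⟧ ⟦ suc k ⟧ ⟦ suc n ⟧
  (A (suc n) (suc k)) (A n (suc k)) (A (suc n) k) (A n k)
  (⟦suc⟧ k) (⟦suc⟧ n) (A-rec (suc n) k) (A-rec n k) (A-row-rec n k))
  where
  step : ∀ K N K′ N′ b₁ a₁ b₀ a₀ → K′ ≡ K + 1ℚ → N′ ≡ N + 1ℚ →
    (K + 1ℚ) * (K + 1ℚ) * b₁ ≡ (K - N′) * (K + N′ + 1ℚ) * b₀ →
    (K + 1ℚ) * (K + 1ℚ) * a₁ ≡ (K - N) * (K + N + 1ℚ) * a₀ →
    (N + 1ℚ - K) * b₀ + (N + K + 1ℚ) * a₀ ≡ 0ℚ →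
    (K + 1ℚ) * (K + 1ℚ) * ((N + 1ℚ - K′) * b₁ + (N + K′ + 1ℚ) * a₁) ≡ (K + 1ℚ) * (K + 1ℚ) * 0ℚ
  step K N _ _ b₁ a₁ b₀ a₀ refl refl rec₁ rec₀ previous = begin
    (K + 1ℚ) * (K + 1ℚ) * ((N + 1ℚ - (K + 1ℚ)) * b₁ + (N + (K + 1ℚ) + 1ℚ) * a₁)
        ≡⟨ solve (K ∷ N ∷ b₁ ∷ a₁ ∷ []) ℚ-ring ⟩
    (N - K) * ((K + 1ℚ) * (K + 1ℚ) * b₁) + (N + K + two) * ((K + 1ℚ) * (K + 1ℚ) * a₁)
        ≡⟨ cong₂ (λ x y → (N - K) * x + (N + K + two) * y) rec₁ rec₀ ⟩
    (N - K) * ((K - (N + 1ℚ)) * (K + (N + 1ℚ) + 1ℚ) * b₀) + (N + K + two) * ((K - N) * (K + N + 1ℚ) * a₀)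
        ≡⟨ solve (K ∷ N ∷ b₀ ∷ a₀ ∷ []) ℚ-ring ⟩
    (K - N) * (K + N + two) * ((N + 1ℚ - K) * b₀ + (N + K + 1ℚ) * a₀)
        ≡⟨ cong ((K - N) * (K + N + two) *_) previous ⟩
    (K - N) * (K + N + two) * 0ℚ
        ≡⟨ solve (K ∷ N ∷ []) ℚ-ring ⟩
    (K + 1ℚ) * (K + 1ℚ) * 0ℚ ∎
    where open ≡-Reasoning

A-row-difference : ∀ n k → A (suc n) k - A n k ≡ two * (⟦ n ⟧ + 1ℚ) * A (suc n) k * 1/suc (n ℕ.+ k)
A-row-difference n k = divide (n ℕ.+ k) (trans
  (cong (λ x → (x + 1ℚ) * (A (suc n) k - A n k)) (⟦+⟧ n k))
  (solve-row ⟦ n ⟧ ⟦ k ⟧ (A (suc n) k) (A n k) (A-row-rec n k)))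
  where
  solve-row : ∀ N K b a → (N + 1ℚ - K) * b + (N + K + 1ℚ) * a ≡ 0ℚ → (N + K + 1ℚ) * (b - a) ≡ two * (N + 1ℚ) * b
  solve-row N K b a row = begin
    (N + K + 1ℚ) * (b - a)                                          ≡⟨ solve (N ∷ K ∷ b ∷ a ∷ []) ℚ-ring ⟩
    two * (N + 1ℚ) * b - ((N + 1ℚ - K) * b + (N + K + 1ℚ) * a)      ≡⟨ cong (λ x → two * (N + 1ℚ) * b - x) row ⟩
    two * (N + 1ℚ) * b - 0ℚ                                         ≡⟨ solve (N ∷ b ∷ []) ℚ-ring ⟩
    two * (N + 1ℚ) * b                                              ∎
    where open ≡-Reasoning

E : ℕ → (ℕ → ℚ) → ℚ
E m f = Σ₀ m (λ k → A m k * f k)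

E-cong : ∀ m {f g : ℕ → ℚ} → (∀ k → f k ≡ g k) → E m f ≡ E m g
E-cong m e = Σ₀-cong m (λ k → cong (A m k *_) (e k))

E-linear : ∀ m a b (f g : ℕ → ℚ) → E m (λ k → a * f k + b * g k) ≡ a * E m f + b * E m g
E-linear m a b f g = trans
  (Σ₀-cong m (λ k → distribute (A m k) a b (f k) (g k)))
  (Σ₀-linear m a b (λ k → A m k * f k) (λ k → A m k * g k))
  where
  distribute : ∀ x a b y z → x * (a * y + b * z) ≡ a * (x * y) + b * (x * z)
  distribute = solve-∀ ℚ-ring

E-scale : ∀ m a (f : ℕ → ℚ) → E m (λ k → a * f k) ≡ a * E m f
E-scale m a f = begin
  E m (λ k → a * f k)                ≡⟨ E-cong m (λ k → pad a (f k)) ⟩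
  E m (λ k → a * f k + 0ℚ * f k)     ≡⟨ E-linear m a 0ℚ f f ⟩
  a * E m f + 0ℚ * E m f             ≡⟨ sym (pad a (E m f)) ⟩
  a * E m f                          ∎
  where
  open ≡-Reasoning
  pad : ∀ a y → a * y ≡ a * y + 0ℚ * y
  pad = solve-∀ ℚ-ring

E-zero : ∀ m {f : ℕ → ℚ} → (∀ k → f k ≡ 0ℚ) → E m f ≡ 0ℚ
E-zero m {f} vanishes = begin
  E m f                   ≡⟨ E-cong m (λ k → trans (vanishes k) (sym (ℚP.*-zeroˡ (f k)))) ⟩
  E m (λ k → 0ℚ * f k)    ≡⟨ E-scale m 0ℚ f ⟩
  0ℚ * E m f              ≡⟨ ℚP.*-zeroˡ (E m f) ⟩
  0ℚ                      ∎
  where open ≡-Reasoning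

-- Summation by parts against A-rec: E_m annihilates the operator adjoint to
-- the column recurrence.  With T(k) = A(m,k)·k²·v(k) the summand is
-- T(k+1) - T(k), and both boundary terms vanish: T(0) because of the factor
-- k², and T(m+1) because A(m,m+1) = 0.
annihilate : ∀ m (v : ℕ → ℚ) →
  E m (λ k → (⟦ k ⟧ - ⟦ m ⟧) * (⟦ k ⟧ + ⟦ m ⟧ + 1ℚ) * v (suc k) - ⟦ k ⟧ * ⟦ k ⟧ * v k) ≡ 0ℚ
annihilate m v = begin
  E m (λ k → (⟦ k ⟧ - ⟦ m ⟧) * (⟦ k ⟧ + ⟦ m ⟧ + 1ℚ) * v (suc k) - ⟦ k ⟧ * ⟦ k ⟧ * v k)
      ≡⟨ Σ₀-cong m (λ k → step ⟦ k ⟧ ⟦ m ⟧ ⟦ suc k ⟧ (A m k) (A m (suc k)) (v k) (v (suc k)) (⟦suc⟧ k) (A-rec m k)) ⟩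
  Σ₀ m (λ k → T (suc k) - T k)       ≡⟨ Σ₀-telescope m T ⟩
  T (suc m) - T 0                     ≡⟨ cong (λ x → x * (⟦ suc m ⟧ * ⟦ suc m ⟧ * v (suc m)) - T 0) (A-vanishes m) ⟩
  0ℚ * (⟦ suc m ⟧ * ⟦ suc m ⟧ * v (suc m)) - A m 0 * (0ℚ * 0ℚ * v 0)
      ≡⟨ boundary (⟦ suc m ⟧ * ⟦ suc m ⟧ * v (suc m)) (A m 0) (v 0) ⟩
  0ℚ                                  ∎
  where
  open ≡-Reasoning
  T : ℕ → ℚ
  T k = A m k * (⟦ k ⟧ * ⟦ k ⟧ * v k)
  boundary : ∀ t a w → 0ℚ * t - a * (0ℚ * 0ℚ * w) ≡ 0ℚ
  boundary = solve-∀ ℚ-ring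
  step : ∀ K M K′ a₀ a₁ v₀ v₁ → K′ ≡ K + 1ℚ →
    (K + 1ℚ) * (K + 1ℚ) * a₁ ≡ (K - M) * (K + M + 1ℚ) * a₀ →
    a₀ * ((K - M) * (K + M + 1ℚ) * v₁ - K * K * v₀) ≡ a₁ * (K′ * K′ * v₁) - a₀ * (K * K * v₀)
  step K M _ a₀ a₁ v₀ v₁ refl rec = begin
    a₀ * ((K - M) * (K + M + 1ℚ) * v₁ - K * K * v₀)         ≡⟨ solve (K ∷ M ∷ a₀ ∷ v₀ ∷ v₁ ∷ []) ℚ-ring ⟩
    (K - M) * (K + M + 1ℚ) * a₀ * v₁ - a₀ * (K * K * v₀)     ≡⟨ cong (λ x → x * v₁ - a₀ * (K * K * v₀)) (sym rec) ⟩
    (K + 1ℚ) * (K + 1ℚ) * a₁ * v₁ - a₀ * (K * K * v₀)       ≡⟨ solve (K ∷ a₀ ∷ a₁ ∷ v₀ ∷ v₁ ∷ []) ℚ-ring ⟩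
    a₁ * ((K + 1ℚ) * (K + 1ℚ) * v₁) - a₀ * (K * K * v₀)     ∎

-- The annihilation relation for the row m = n+1 with v(k) = f(k)/(n+k+1):
-- (n+1)²·E_{n+1}(f(k)/(n+k+1)) = E_{n+1}((k-n-1)·(f(k+1) - f(k))).
row-moment : ∀ n (f : ℕ → ℚ) →
  (⟦ n ⟧ + 1ℚ) * (⟦ n ⟧ + 1ℚ) * E (suc n) (λ k → f k * 1/suc (n ℕ.+ k))
    ≡ E (suc n) (λ k → (⟦ k ⟧ - (⟦ n ⟧ + 1ℚ)) * (f (suc k) - f k))
row-moment n f = begin
  M * M * X                                      ≡⟨ isolate (M * M) X Y ⟩
  Y - (- (M * M) * X + 1ℚ * Y)                   ≡⟨ cong (λ x → Y - x) (sym (E-linear (suc n) (- (M * M)) 1ℚ F G)) ⟩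
  Y - E (suc n) (λ k → - (M * M) * F k + 1ℚ * G k) ≡⟨ cong (λ x → Y - x) relation ⟩
  Y - 0ℚ                                         ≡⟨ ℚP.+-identityʳ Y ⟩
  Y                                              ∎
  where
  open ≡-Reasoning
  M = ⟦ n ⟧ + 1ℚ
  F : ℕ → ℚ
  F k = f k * 1/suc (n ℕ.+ k)
  G : ℕ → ℚ
  G k = (⟦ k ⟧ - M) * (f (suc k) - f k)
  X = E (suc n) F
  Y = E (suc n) G
  isolate : ∀ c x y → c * x ≡ y - (- c * x + 1ℚ * y)
  isolate = solve-∀ ℚ-ring
  pointwise : ∀ K N N′ f₀ f₁ i₀ i₁ → N′ ≡ N + 1ℚ → (N + K + 1ℚ) * i₀ ≡ 1ℚ → (N + (K + 1ℚ) + 1ℚ) * i₁ ≡ 1ℚ →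
    (K - N′) * (K + N′ + 1ℚ) * (f₁ * i₁) - K * K * (f₀ * i₀)
      ≡ - ((N + 1ℚ) * (N + 1ℚ)) * (f₀ * i₀) + 1ℚ * ((K - (N + 1ℚ)) * (f₁ - f₀))
  pointwise K N _ f₀ f₁ i₀ i₁ refl r₀ r₁ = begin
    (K - (N + 1ℚ)) * (K + (N + 1ℚ) + 1ℚ) * (f₁ * i₁) - K * K * (f₀ * i₀)
        ≡⟨ solve (K ∷ N ∷ f₀ ∷ f₁ ∷ i₀ ∷ i₁ ∷ []) ℚ-ring ⟩
    (K - (N + 1ℚ)) * f₁ * ((N + (K + 1ℚ) + 1ℚ) * i₁) - (K - (N + 1ℚ)) * f₀ * ((N + K + 1ℚ) * i₀)
      - (N + 1ℚ) * (N + 1ℚ) * (f₀ * i₀)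
        ≡⟨ cong₂ (λ x y → (K - (N + 1ℚ)) * f₁ * x - (K - (N + 1ℚ)) * f₀ * y - (N + 1ℚ) * (N + 1ℚ) * (f₀ * i₀)) r₁ r₀ ⟩
    (K - (N + 1ℚ)) * f₁ * 1ℚ - (K - (N + 1ℚ)) * f₀ * 1ℚ - (N + 1ℚ) * (N + 1ℚ) * (f₀ * i₀)
        ≡⟨ solve (K ∷ N ∷ f₀ ∷ f₁ ∷ i₀ ∷ []) ℚ-ring ⟩
    - ((N + 1ℚ) * (N + 1ℚ)) * (f₀ * i₀) + 1ℚ * ((K - (N + 1ℚ)) * (f₁ - f₀)) ∎
  relation : E (suc n) (λ k → - (M * M) * F k + 1ℚ * G k) ≡ 0ℚ
  relation = trans
    (E-cong (suc n) (λ k → sym (pointwise ⟦ k ⟧ ⟦ n ⟧ ⟦ suc n ⟧ (f k) (f (suc k))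
      (1/suc (n ℕ.+ k)) (1/suc (n ℕ.+ suc k)) (⟦suc⟧ n) (1/suc-sum n k)
      (trans (cong (λ x → (⟦ n ⟧ + x + 1ℚ) * 1/suc (n ℕ.+ suc k)) (sym (⟦suc⟧ k))) (1/suc-sum n (suc k))))))
    (annihilate (suc n) F)

row-transfer : ∀ n (f : ℕ → ℚ) →
  E (suc n) f ≡ E n f + two * (⟦ n ⟧ + 1ℚ) * E (suc n) (λ k → f k * 1/suc (n ℕ.+ k))
row-transfer n f = begin
  E (suc n) f
      ≡⟨ Σ₀-cong (suc n) (λ k → split (A (suc n) k) (A n k) (f k) c (1/suc (n ℕ.+ k)) (A-row-difference n k)) ⟩
  Σ₀ (suc n) (λ k → 1ℚ * (A n k * f k) + c * (A (suc n) k * F k))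
      ≡⟨ Σ₀-linear (suc n) 1ℚ c (λ k → A n k * f k) (λ k → A (suc n) k * F k) ⟩
  1ℚ * (E n f + A n (suc n) * f (suc n)) + c * E (suc n) F
      ≡⟨ cong (λ x → 1ℚ * (E n f + x * f (suc n)) + c * E (suc n) F) (A-vanishes n) ⟩
  1ℚ * (E n f + 0ℚ * f (suc n)) + c * E (suc n) F
      ≡⟨ drop (E n f) (f (suc n)) (c * E (suc n) F) ⟩
  E n f + c * E (suc n) F                      ∎
  where
  open ≡-Reasoning
  c = two * (⟦ n ⟧ + 1ℚ)
  F : ℕ → ℚ
  F k = f k * 1/suc (n ℕ.+ k)
  drop : ∀ e x y → 1ℚ * (e + 0ℚ * x) + y ≡ e + y
  drop = solve-∀ ℚ-ring
  split : ∀ b a x c i → b - a ≡ c * b * i → b * x ≡ 1ℚ * (a * x) + c * (b * (x * i))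
  split b a x c i difference = begin
    b * x                          ≡⟨ solve (b ∷ a ∷ x ∷ []) ℚ-ring ⟩
    1ℚ * (a * x) + (b - a) * x     ≡⟨ cong (λ y → 1ℚ * (a * x) + y * x) difference ⟩
    1ℚ * (a * x) + c * b * i * x   ≡⟨ solve (b ∷ a ∷ x ∷ c ∷ i ∷ []) ℚ-ring ⟩
    1ℚ * (a * x) + c * (b * (x * i)) ∎

row-step : ∀ n (f : ℕ → ℚ) →
  (⟦ n ⟧ + 1ℚ) * (E (suc n) f - E n f) ≡ two * E (suc n) (λ k → (⟦ k ⟧ - (⟦ n ⟧ + 1ℚ)) * (f (suc k) - f k))
row-step n f = begin
  M * (E (suc n) f - E n f)              ≡⟨ cong (λ x → M * (x - E n f)) (row-transfer n f) ⟩
  M * ((E n f + two * M * X) - E n f)    ≡⟨ difference M (E n f) X ⟩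
  two * (M * M * X)                      ≡⟨ cong (two *_) (row-moment n f) ⟩
  two * E (suc n) (λ k → (⟦ k ⟧ - M) * (f (suc k) - f k)) ∎
  where
  open ≡-Reasoning
  M = ⟦ n ⟧ + 1ℚ
  X = E (suc n) (λ k → f k * 1/suc (n ℕ.+ k))
  difference : ∀ M e x → M * ((e + two * M * x) - e) ≡ two * (M * M * x)
  difference = solve-∀ ℚ-ring

-- Moments of the rows

-- Σ_k A(m,k) = 1: the constants are unchanged by row-step.
total : ∀ m → E m (λ _ → 1ℚ) ≡ 1ℚ
total zero = refl
total (suc n) = cancel n (begin
  M * E (suc n) one                               ≡⟨ split M (E (suc n) one) (E n one) ⟩
  M * (E (suc n) one - E n one) + M * E n one     ≡⟨ cong₂ (λ x y → x + M * y) (row-step n one) (total n) ⟩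
  two * E (suc n) (λ k → (⟦ k ⟧ - M) * (1ℚ - 1ℚ)) + M * 1ℚ
      ≡⟨ cong (λ x → two * x + M * 1ℚ) (E-zero (suc n) (λ k → no-increment ⟦ k ⟧ M)) ⟩
  two * 0ℚ + M * 1ℚ                               ≡⟨ ℚP.+-identityˡ (M * 1ℚ) ⟩
  M * 1ℚ                                          ∎)
  where
  open ≡-Reasoning
  M = ⟦ n ⟧ + 1ℚ
  one : ℕ → ℚ
  one _ = 1ℚ
  split : ∀ M x y → M * x ≡ M * (x - y) + M * y
  split = solve-∀ ℚ-ring
  no-increment : ∀ K M → (K - M) * (1ℚ - 1ℚ) ≡ 0ℚ
  no-increment = solve-∀ ℚ-ring

-- recip k = 1/k for k ≥ 1 (and 0 at k = 0), so that k²·recip k = k.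
recip : ℕ → ℚ
recip zero = 0ℚ
recip (suc k) = 1/suc k

square-recip : ∀ k → ⟦ k ⟧ * ⟦ k ⟧ * recip k ≡ ⟦ k ⟧
square-recip zero = refl
square-recip (suc k) = begin
  ⟦ suc k ⟧ * ⟦ suc k ⟧ * 1/suc k      ≡⟨ cong (λ x → x * x * 1/suc k) (⟦suc⟧ k) ⟩
  (K + 1ℚ) * (K + 1ℚ) * 1/suc k        ≡⟨ ℚP.*-assoc (K + 1ℚ) (K + 1ℚ) (1/suc k) ⟩
  (K + 1ℚ) * ((K + 1ℚ) * 1/suc k)      ≡⟨ cong ((K + 1ℚ) *_) (1/suc-inverse k) ⟩
  (K + 1ℚ) * 1ℚ                        ≡⟨ ℚP.*-identityʳ (K + 1ℚ) ⟩
  K + 1ℚ                               ≡⟨ sym (⟦suc⟧ k) ⟩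
  ⟦ suc k ⟧                            ∎
  where
  open ≡-Reasoning
  K = ⟦ k ⟧

-- Σ_k A(m,k)/(k+1) = 0 for m ≥ 1: annihilate with v = recip.
inverse-moment : ∀ m → ⟦ m ⟧ * (⟦ m ⟧ + 1ℚ) * E m 1/suc ≡ 0ℚ
inverse-moment m = begin
  c * E m 1/suc                   ≡⟨ negate c (E m 1/suc) ⟩
  - (- c * E m 1/suc)             ≡⟨ cong -_ (sym (E-scale m (- c) 1/suc)) ⟩
  - E m (λ k → - c * 1/suc k)     ≡⟨ cong -_ relation ⟩
  - 0ℚ                            ≡⟨ refl ⟩
  0ℚ                              ∎
  where
  open ≡-Reasoning
  M = ⟦ m ⟧
  c = M * (M + 1ℚ)
  negate : ∀ c x → c * x ≡ - (- c * x)
  negate = solve-∀ ℚ-ring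
  pointwise : ∀ K M i r → K * K * r ≡ K → (K + 1ℚ) * i ≡ 1ℚ →
    (K - M) * (K + M + 1ℚ) * i - K * K * r ≡ - (M * (M + 1ℚ)) * i
  pointwise K M i r square inverse = begin
    (K - M) * (K + M + 1ℚ) * i - K * K * r           ≡⟨ cong (λ x → (K - M) * (K + M + 1ℚ) * i - x) square ⟩
    (K - M) * (K + M + 1ℚ) * i - K                   ≡⟨ solve (K ∷ M ∷ i ∷ []) ℚ-ring ⟩
    - (M * (M + 1ℚ)) * i + K * ((K + 1ℚ) * i) - K    ≡⟨ cong (λ x → - (M * (M + 1ℚ)) * i + K * x - K) inverse ⟩
    - (M * (M + 1ℚ)) * i + K * 1ℚ - K                ≡⟨ solve (K ∷ M ∷ i ∷ []) ℚ-ring ⟩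
    - (M * (M + 1ℚ)) * i                             ∎
  relation : E m (λ k → - c * 1/suc k) ≡ 0ℚ
  relation = trans
    (E-cong m (λ k → sym (pointwise ⟦ k ⟧ M (1/suc k) (recip k) (square-recip k) (1/suc-inverse k))))
    (annihilate m recip)

-- The increment of H seen by row-step: E_{n+1}((k-n-1)/(k+1)) = 1, because
-- (k-n-1)/(k+1) = 1 - (n+2)/(k+1).
harmonic-increment-moment : ∀ n → E (suc n) (λ k → (⟦ k ⟧ - (⟦ n ⟧ + 1ℚ)) * (H (suc k) - H k)) ≡ 1ℚ
harmonic-increment-moment n = begin
  E (suc n) (λ k → (⟦ k ⟧ - M) * (H (suc k) - H k))
      ≡⟨ E-cong (suc n) (λ k → pointwise ⟦ k ⟧ M (H k) (1/suc k) (1/suc-inverse k)) ⟩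
  E (suc n) (λ k → 1ℚ * 1ℚ + (- (M + 1ℚ)) * 1/suc k)
      ≡⟨ E-linear (suc n) 1ℚ (- (M + 1ℚ)) (λ _ → 1ℚ) 1/suc ⟩
  1ℚ * E (suc n) (λ _ → 1ℚ) + (- (M + 1ℚ)) * S
      ≡⟨ conclude M (E (suc n) (λ _ → 1ℚ)) S (total (suc n)) (cancel n (vanish ⟦ suc n ⟧ M S (⟦suc⟧ n) (inverse-moment (suc n)))) ⟩
  1ℚ                                                  ∎
  where
  open ≡-Reasoning
  M = ⟦ n ⟧ + 1ℚ
  S = E (suc n) 1/suc
  pointwise : ∀ K M h i → (K + 1ℚ) * i ≡ 1ℚ → (K - M) * ((h + i) - h) ≡ 1ℚ * 1ℚ + (- (M + 1ℚ)) * i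
  pointwise K M h i inverse = begin
    (K - M) * ((h + i) - h)                             ≡⟨ solve (K ∷ M ∷ h ∷ i ∷ []) ℚ-ring ⟩
    1ℚ * 1ℚ + (- (M + 1ℚ)) * i + ((K + 1ℚ) * i - 1ℚ)    ≡⟨ cong (λ x → 1ℚ * 1ℚ + (- (M + 1ℚ)) * i + (x - 1ℚ)) inverse ⟩
    1ℚ * 1ℚ + (- (M + 1ℚ)) * i + (1ℚ - 1ℚ)              ≡⟨ solve (M ∷ i ∷ []) ℚ-ring ⟩
    1ℚ * 1ℚ + (- (M + 1ℚ)) * i                          ∎
  vanish : ∀ M′ M S → M′ ≡ M → M′ * (M′ + 1ℚ) * S ≡ 0ℚ → M * ((M + 1ℚ) * S) ≡ M * 0ℚ
  vanish _ M S refl moment = begin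
    M * ((M + 1ℚ) * S)    ≡⟨ sym (ℚP.*-assoc M (M + 1ℚ) S) ⟩
    M * (M + 1ℚ) * S      ≡⟨ moment ⟩
    0ℚ                    ≡⟨ sym (ℚP.*-zeroʳ M) ⟩
    M * 0ℚ                ∎
  conclude : ∀ M e S → e ≡ 1ℚ → (M + 1ℚ) * S ≡ 0ℚ → 1ℚ * e + (- (M + 1ℚ)) * S ≡ 1ℚ
  conclude M e S e≡1 moment = begin
    1ℚ * e + (- (M + 1ℚ)) * S    ≡⟨ solve (M ∷ e ∷ S ∷ []) ℚ-ring ⟩
    1ℚ * e - (M + 1ℚ) * S        ≡⟨ cong₂ (λ x y → 1ℚ * x - y) e≡1 moment ⟩
    1ℚ * 1ℚ - 0ℚ                 ≡⟨ refl ⟩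
    1ℚ                           ∎

harmonic-moment : ∀ m → E m H ≡ two * H m
harmonic-moment zero = refl
harmonic-moment (suc n) = step (E (suc n) H) (E n H) (H n) (1/suc n) (harmonic-moment n)
  (divide n (trans (row-step n H) (cong (two *_) (harmonic-increment-moment n))))
  where
  step : ∀ x y h i → y ≡ two * h → x - y ≡ two * 1ℚ * i → x ≡ two * (h + i)
  step x y h i previous increment = begin
    x                          ≡⟨ solve (x ∷ y ∷ []) ℚ-ring ⟩
    y + (x - y)                ≡⟨ cong₂ _+_ previous increment ⟩
    two * h + two * 1ℚ * i     ≡⟨ solve (h ∷ i ∷ []) ℚ-ring ⟩
    two * (h + i)              ∎
    where open ≡-Reasoning

-- Σ_k A(m,k)·k = m(m+1): annihilate with v = 1 gives E_m k - m(m+1)·E_m 1 = 0.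
first-moment : ∀ m → E m ⟦_⟧ ≡ ⟦ m ⟧ * (⟦ m ⟧ + 1ℚ)
first-moment m = conclude (E m ⟦_⟧) (E m one) c (total m) (begin
  1ℚ * E m ⟦_⟧ + (- c) * E m one                   ≡⟨ sym (E-linear m 1ℚ (- c) ⟦_⟧ one) ⟩
  E m (λ k → 1ℚ * ⟦ k ⟧ + (- c) * 1ℚ)              ≡⟨ E-cong m (λ k → pointwise ⟦ k ⟧ M) ⟩
  E m (λ k → (⟦ k ⟧ - M) * (⟦ k ⟧ + M + 1ℚ) * 1ℚ - ⟦ k ⟧ * ⟦ k ⟧ * 1ℚ) ≡⟨ annihilate m one ⟩
  0ℚ                                               ∎)
  where
  open ≡-Reasoning
  M = ⟦ m ⟧
  c = M * (M + 1ℚ)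
  one : ℕ → ℚ
  one _ = 1ℚ
  pointwise : ∀ K M → 1ℚ * K + (- (M * (M + 1ℚ))) * 1ℚ ≡ (K - M) * (K + M + 1ℚ) * 1ℚ - K * K * 1ℚ
  pointwise = solve-∀ ℚ-ring
  conclude : ∀ x e c → e ≡ 1ℚ → 1ℚ * x + (- c) * e ≡ 0ℚ → x ≡ c
  conclude x e c e≡1 relation = begin
    x                              ≡⟨ solve (x ∷ e ∷ c ∷ []) ℚ-ring ⟩
    (1ℚ * x + (- c) * e) + c * e   ≡⟨ cong₂ (λ y z → y + c * z) relation e≡1 ⟩
    0ℚ + c * 1ℚ                    ≡⟨ solve (c ∷ []) ℚ-ring ⟩
    c                              ∎

-- Σ_k A(m,k)·k·H_k = m(m+1)(2H_m - 1): annihilate with v(k) = H_k - 1/k gives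
-- E_m(k·H_k) + E_m k - m(m+1)·E_m H = 0.
weighted-harmonic-moment : ∀ m → E m (λ k → ⟦ k ⟧ * H k) ≡ ⟦ m ⟧ * (⟦ m ⟧ + 1ℚ) * (two * H m - 1ℚ)
weighted-harmonic-moment m =
  conclude (E m (λ k → ⟦ k ⟧ * H k)) (E m ⟦_⟧) (E m H) c (H m) relation (first-moment m) (harmonic-moment m)
  where
  open ≡-Reasoning
  M = ⟦ m ⟧
  c = M * (M + 1ℚ)
  v : ℕ → ℚ
  v k = H k - recip k
  pointwise : ∀ K M h i r → K * K * r ≡ K →
    (K - M) * (K + M + 1ℚ) * ((h + i) - i) - K * K * (h - r) ≡ 1ℚ * (K * h) + 1ℚ * (1ℚ * K + (- (M * (M + 1ℚ))) * h)
  pointwise K M h i r square = begin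
    (K - M) * (K + M + 1ℚ) * ((h + i) - i) - K * K * (h - r)   ≡⟨ solve (K ∷ M ∷ h ∷ i ∷ r ∷ []) ℚ-ring ⟩
    (K - M) * (K + M + 1ℚ) * h - K * K * h + K * K * r         ≡⟨ cong (λ x → (K - M) * (K + M + 1ℚ) * h - K * K * h + x) square ⟩
    (K - M) * (K + M + 1ℚ) * h - K * K * h + K                 ≡⟨ solve (K ∷ M ∷ h ∷ []) ℚ-ring ⟩
    1ℚ * (K * h) + 1ℚ * (1ℚ * K + (- (M * (M + 1ℚ))) * h)     ∎
  relation : 1ℚ * E m (λ k → ⟦ k ⟧ * H k) + 1ℚ * (1ℚ * E m ⟦_⟧ + (- c) * E m H) ≡ 0ℚ
  relation = begin
    1ℚ * E m (λ k → ⟦ k ⟧ * H k) + 1ℚ * (1ℚ * E m ⟦_⟧ + (- c) * E m H)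
        ≡⟨ cong (λ y → 1ℚ * E m (λ k → ⟦ k ⟧ * H k) + 1ℚ * y) (sym (E-linear m 1ℚ (- c) ⟦_⟧ H)) ⟩
    1ℚ * E m (λ k → ⟦ k ⟧ * H k) + 1ℚ * E m (λ k → 1ℚ * ⟦ k ⟧ + (- c) * H k)
        ≡⟨ sym (E-linear m 1ℚ 1ℚ (λ k → ⟦ k ⟧ * H k) (λ k → 1ℚ * ⟦ k ⟧ + (- c) * H k)) ⟩
    E m (λ k → 1ℚ * (⟦ k ⟧ * H k) + 1ℚ * (1ℚ * ⟦ k ⟧ + (- c) * H k))
        ≡⟨ E-cong m (λ k → sym (pointwise ⟦ k ⟧ M (H k) (1/suc k) (recip k) (square-recip k))) ⟩
    E m (λ k → (⟦ k ⟧ - M) * (⟦ k ⟧ + M + 1ℚ) * v (suc k) - ⟦ k ⟧ * ⟦ k ⟧ * v k)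
        ≡⟨ annihilate m v ⟩
    0ℚ ∎
  conclude : ∀ x e h c h′ → 1ℚ * x + 1ℚ * (1ℚ * e + (- c) * h) ≡ 0ℚ → e ≡ c → h ≡ two * h′ → x ≡ c * (two * h′ - 1ℚ)
  conclude x e h c h′ relation first harmonic = begin
    x                                              ≡⟨ solve (x ∷ e ∷ h ∷ c ∷ []) ℚ-ring ⟩
    (1ℚ * x + 1ℚ * (1ℚ * e + (- c) * h)) - e + c * h
        ≡⟨ cong₂ (λ y z → y - z + c * h) relation first ⟩
    0ℚ - c + c * h                                 ≡⟨ cong (λ z → 0ℚ - c + c * z) harmonic ⟩
    0ℚ - c + c * (two * h′)                        ≡⟨ solve (c ∷ h′ ∷ []) ℚ-ring ⟩
    c * (two * h′ - 1ℚ)                            ∎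

mainTheorem5 : (n : ℕ) → 1 ℕ.≤ n →
    Σ₁ n (λ k → ℕ→ℚ (n C k) * ℕ→ℚ ((n ℕ.+ k) C k) * sign (n ∸ k) * ℕ→ℚ k * H k)
      ≡ ℕ→ℚ n * ℕ→ℚ (n ℕ.+ 1) * (ℕ→ℚ 2 * H n - 1ℚ)
mainTheorem5 n _ = begin
  Σ₁ n f                                   ≡⟨ zero-term (Σ₁ n f) (A n 0) ⟩
  f 0 + Σ₁ n f                             ≡⟨ sym (Σ₀-Σ₁ n f) ⟩
  Σ₀ n f                                   ≡⟨ Σ₀-cong n (λ k → ℚP.*-assoc (A n k) ⟦ k ⟧ (H k)) ⟩
  E n (λ k → ⟦ k ⟧ * H k)                  ≡⟨ weighted-harmonic-moment n ⟩
  ⟦ n ⟧ * (⟦ n ⟧ + 1ℚ) * (two * H n - 1ℚ)  ≡⟨ cong (λ x → ⟦ n ⟧ * x * (two * H n - 1ℚ)) (sym (⟦+⟧ n 1)) ⟩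
  ⟦ n ⟧ * ⟦ n ℕ.+ 1 ⟧ * (⟦ 2 ⟧ * H n - 1ℚ) ∎
  where
  open ≡-Reasoning
  f : ℕ → ℚ
  f k = A n k * ⟦ k ⟧ * H k
  zero-term : ∀ s a → s ≡ a * 0ℚ * 0ℚ + s
  zero-term = solve-∀ ℚ-ring
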